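{- For all graphs $G_1$ and $G_2$, $\chi_i(G_1 \cup G_2) \leq \chi_i(G_1) + \chi_i(G_2)$.
   Context: $G_1\cup G_2$ is the graph with vertex set $V(G_1)\cup V(G_2)$ and edge set $E(G_1)\cup E(G_2)$. For a graph $G$, let $D(G)$ be the digraph obtained by replacing each edge $uv$ by the two opposite arcs $uv$ and $vu$, with arc set $A(G)$. Two distinct arcs $uv$ and $xy$ are adjacent if $u=x$, or $v=x$, or $y=u$. An incidence coloring is a map $\sigma: A(G)\to C$ assigning distinct colors to adjacent arcs; the incidence chromatic number $\chi_i(G)$ is the minimum $|C|$ over all incidence colorings. -}

module Defs where

open import Data.Nat using (ℕ; _<_)
open import Data.Fin using (Fin)
open import Data.Bool using (Bool; true; false; _∨_)
open import Data.Product using (_×_; Σ-syntax)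
open import Data.Sum using (_⊎_)
open import Relation.Binary.PropositionalEquality using (_≡_; _≢_)
open import Relation.Nullary using (¬_)
open import Data.Bool.Properties using (∨-zeroʳ)
open import Relation.Binary.PropositionalEquality using (refl)

-- A finite simple graph whose vertices form a subset of the ground set Fin n.
-- Both graphs of a union are taken over a common ground set Fin n
-- (any two finite graphs can be placed in one).
record Graph (n : ℕ) : Set where
  field
    vert     : Fin n → Bool
    adj      : Fin n → Fin n → Bool
    adj-sym  : ∀ u v → adj u v ≡ true → adj v u ≡ true
    adj-irr  : ∀ u → adj u u ≡ false
    adj-vert : ∀ u v → adj u v ≡ true → vert u ≡ true
open Graph public

_∪ᴳ_ : ∀ {n} → Graph n → Graph n → Graph n
vert (G ∪ᴳ H) u = vert G u ∨ vert H u
adj (G ∪ᴳ H) u v = adj G u v ∨ adj H u v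
adj-sym (G ∪ᴳ H) u v p with adj G u v in eG | adj H u v in eH
... | true  | _     rewrite adj-sym G u v eG = refl
... | false | true  rewrite adj-sym H u v eH = ∨-zeroʳ (adj G v u)
adj-irr (G ∪ᴳ H) u rewrite adj-irr G u | adj-irr H u = refl
adj-vert (G ∪ᴳ H) u v p with adj G u v in eG | adj H u v in eH
... | true  | _    rewrite adj-vert G u v eG = refl
... | false | true rewrite adj-vert H u v eH = ∨-zeroʳ (vert G u)

Arc : ∀ {n} → Graph n → Fin n → Fin n → Set
Arc G u v = adj G u v ≡ true

AdjacentArcs : ∀ {n} → Fin n → Fin n → Fin n → Fin n → Set
AdjacentArcs u v x y = (u ≡ x ⊎ v ≡ x ⊎ y ≡ u)

-- An incidence coloring of G with colour set Fin k: σ u v is the colour of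
-- arc uv (values on non-arcs are irrelevant); adjacent distinct arcs get
-- distinct colours.
IsIncidenceColoring : ∀ {n} (G : Graph n) (k : ℕ) → (Fin n → Fin n → Fin k) → Set
IsIncidenceColoring G k σ =
  ∀ u v x y → Arc G u v → Arc G x y → ¬ (u ≡ x × v ≡ y) →
  AdjacentArcs u v x y → σ u v ≢ σ x y

IncidenceColorable : ∀ {n} → Graph n → ℕ → Set
IncidenceColorable {n} G k = Σ[ σ ∈ (Fin n → Fin n → Fin k) ] IsIncidenceColoring G k σ

IncidenceChromaticNumber : ∀ {n} → Graph n → ℕ → Set
IncidenceChromaticNumber G k =
  IncidenceColorable G k × (∀ j → j < k → ¬ IncidenceColorable G j)

-- Colour G₁ ∪ G₂ with the disjoint union of optimal palettes for G₁ and G₂: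
-- an arc of G₁ keeps its G₁-colour, any other arc (necessarily of G₂) keeps its
-- G₂-colour. Two arcs with the same colour then lie in the same Gᵢ, where they
-- are not adjacent.
module Submission where

open import Defs
open import Data.Nat using (ℕ; _≤_; _+_)
open import Data.Nat.Properties using (≮⇒≥)
open import Data.Fin using (Fin; join; splitAt)
open import Data.Fin.Properties using (splitAt-join)
open import Data.Bool using (true; false; if_then_else_)
open import Data.Sum using (_⊎_; inj₁; inj₂)
open import Data.Sum.Properties using (inj₁-injective; inj₂-injective)
open import Data.Product using (_×_; _,_)
open import Relation.Binary.PropositionalEquality using (_≡_; _≢_; sym; trans; cong)
open import Relation.Nullary using (¬_)
open import Function using (_∘_)

join-injective : ∀ m n {i j : Fin m ⊎ Fin n} → join m n i ≡ join m n j → i ≡ j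
join-injective m n {i} {j} eq =
  trans (sym (splitAt-join m n i)) (trans (cong (splitAt m) eq) (splitAt-join m n j))

incidenceColorable-∪ : ∀ {n} (G₁ G₂ : Graph n) {k₁ k₂ : ℕ} →
  IncidenceColorable G₁ k₁ → IncidenceColorable G₂ k₂ →
  IncidenceColorable (G₁ ∪ᴳ G₂) (k₁ + k₂)
incidenceColorable-∪ {n} G₁ G₂ {k₁} {k₂} (σ₁ , proper₁) (σ₂ , proper₂) = σ , proper
  where
  palette : Fin n → Fin n → Fin k₁ ⊎ Fin k₂
  palette u v = if adj G₁ u v then inj₁ (σ₁ u v) else inj₂ (σ₂ u v)

  σ : Fin n → Fin n → Fin (k₁ + k₂)
  σ u v = join k₁ k₂ (palette u v)

  properPalette : ∀ u v x y → Arc (G₁ ∪ᴳ G₂) u v → Arc (G₁ ∪ᴳ G₂) x y →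
    ¬ (u ≡ x × v ≡ y) → AdjacentArcs u v x y → palette u v ≢ palette x y
  properPalette u v x y uv xy distinct adjacent
    with adj G₁ u v in uv₁ | adj G₁ x y in xy₁
  ... | true  | true  = proper₁ u v x y uv₁ xy₁ distinct adjacent ∘ inj₁-injective
  ... | false | false = proper₂ u v x y uv xy distinct adjacent ∘ inj₂-injective
  ... | true  | false = λ ()
  ... | false | true  = λ ()

  proper : IsIncidenceColoring (G₁ ∪ᴳ G₂) (k₁ + k₂) σ
  proper u v x y uv xy distinct adjacent =
    properPalette u v x y uv xy distinct adjacent ∘ join-injective k₁ k₂

incidenceChromaticNumber-minimal : ∀ {n} (G : Graph n) {k j : ℕ} →
  IncidenceChromaticNumber G k → IncidenceColorable G j → k ≤ j
incidenceChromaticNumber-minimal G {j = j} (_ , minimal) colorable =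
  ≮⇒≥ (λ j<k → minimal j j<k colorable)

theorem4p1 : ∀ {n} (G₁ G₂ : Graph n) (k₁ k₂ k : ℕ) →
    IncidenceChromaticNumber G₁ k₁ →
    IncidenceChromaticNumber G₂ k₂ →
    IncidenceChromaticNumber (G₁ ∪ᴳ G₂) k →
    k ≤ k₁ + k₂
theorem4p1 G₁ G₂ k₁ k₂ k (colorable₁ , _) (colorable₂ , _) χ =
  incidenceChromaticNumber-minimal (G₁ ∪ᴳ G₂) χ
    (incidenceColorable-∪ G₁ G₂ colorable₁ colorable₂)
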